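{- There is no deterministic online algorithm for the discrete data-center optimization problem that achieves a competitive ratio $c<3$.
   Context: Discrete data-center optimization problem: given $T,m\in\mathbb{N}$, $\beta>0$ and convex functions $f_1,\dots,f_T:\{0,\dots,m\}\to\mathbb{R}_{\ge0}$, a schedule $X=(x_1,\dots,x_T)\in\{0,\dots,m\}^T$ with $x_0=0$ has cost $\sum_{t=1}^T f_t(x_t)+\beta\sum_{t=1}^T(x_t-x_{t-1})^+$, $(y)^+=\max(0,y)$. In the online version, at time $t$ the algorithm knows only $f_1,\dots,f_t$ (and $m,\beta$) and must choose $x_t$ irrevocably. An online algorithm has competitive ratio $c$ (is $c$-competitive) if on every instance its cost is at most $c$ times the cost of an optimal (offline) schedule.
   Formalization: The competitive ratio c ranges over ℚ, and the parameter β and the values of the convex functions $f_t$ are taken in ℚ in place of $\mathbb{R}_{\ge0}$ and the reals. -}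

module Defs where

open import Data.Nat using (ℕ; zero; suc; _∸_) renaming (_<_ to _<ℕ_)
open import Data.Integer using (+_)
open import Data.Fin using (Fin; toℕ; fromℕ<)
open import Data.Vec using (Vec; []; _∷_; _∷ʳ_; lookup)
open import Data.Rational using (ℚ; _/_; _+_; _*_; _≤_; _<_; 0ℚ)
open import Data.Product using (Σ; _×_)
open import Relation.Nullary using (¬_)

ℕ→ℚ : ℕ → ℚ
ℕ→ℚ n = + n / 1

Fn : ℕ → Set
Fn m = Fin (suc m) → ℚ

NonNeg : ∀ {m} → Fn m → Set
NonNeg {m} f = ∀ (x : Fin (suc m)) → 0ℚ ≤ f x

Convex : ∀ {m} → Fn m → Set
Convex {m} f = ∀ (x : ℕ) (p : x <ℕ suc m) (q : suc x <ℕ suc m)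
  (r : suc (suc x) <ℕ suc m) →
  ℕ→ℚ 2 * f (fromℕ< q) ≤ f (fromℕ< p) + f (fromℕ< r)

-- Total cost of schedule xs on functions fs, previous state `prev`
-- (x₀ = 0 corresponds to prev = 0); (x_t - x_{t-1})⁺ = x_t ∸ x_{t-1}.
costFrom : ∀ {m T} → ℚ → ℕ → Vec (Fn m) T → Vec (Fin (suc m)) T → ℚ
costFrom β prev [] [] = 0ℚ
costFrom β prev (f ∷ fs) (x ∷ xs) =
  f x + β * ℕ→ℚ (toℕ x ∸ prev) + costFrom β (toℕ x) fs xs

cost : ∀ {m T} → ℚ → Vec (Fn m) T → Vec (Fin (suc m)) T → ℚ
cost β fs xs = costFrom β 0 fs xs

-- A deterministic online algorithm: given m, β and the functions
-- f₁,…,f_t revealed so far (t ≥ 1, in order), it outputs x_t.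
OnlineAlg : Set
OnlineAlg = (m : ℕ) → (β : ℚ) → ∀ {t} → Vec (Fn m) (suc t) → Fin (suc m)

runFrom : OnlineAlg → ∀ {m k T} → ℚ → Vec (Fn m) k → Vec (Fn m) T → Vec (Fin (suc m)) T
runFrom A β hist [] = []
runFrom A {m} β hist (f ∷ fs) = A m β (hist ∷ʳ f) ∷ runFrom A β (hist ∷ʳ f) fs

run : OnlineAlg → ∀ {m T} → ℚ → Vec (Fn m) T → Vec (Fin (suc m)) T
run A β fs = runFrom A β [] fs

-- A is c-competitive: on every valid instance, its cost is at most
-- c times the cost of every (in particular an optimal) offline schedule.
Competitive : OnlineAlg → ℚ → Set
Competitive A c =
  ∀ (T m : ℕ) (β : ℚ) → 0ℚ < β →
  (fs : Vec (Fn m) T) →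
  (∀ (i : Fin T) → NonNeg (lookup fs i) × Convex (lookup fs i)) →
  (X : Vec (Fin (suc m)) T) →
  cost β fs (run A β fs) ≤ c * cost β fs X

module Submission where

-- Instance: m = 1 (states off = 0 and on = 1), switching cost β = N, and
-- at time t the function  F(x_{t-1})  where  F y z = 1 if z = y, else 0:
-- the adversary penalises exactly the state the algorithm is in.  Each step
-- of the algorithm is then a stay (cost 1), an up-move (cost N) or a
-- down-move (cost 0).  With H stays, U up- and D down-moves in n steps,
-- its cost is  α = H + N·U, where H + U + D = n and D ≤ U.
--
-- Three offline schedules bound the optimum: always off (cost Z), always on
-- (cost ≤ O + N, where Z + O = n) and always opposite to the request
-- (cost ≤ N + N·D).  If s·α ≤ e·cost for all three, where 3s = e + 1
-- (ratio e/s = 3 - 1/s), then summing gives (e+1)·α ≤ e·(n + 2N + N·D);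
-- for N = 4e this forces α ≤ 4eN although α ≥ n, so the horizon is short.
-- Every c < 3 with denominator s is at most (3s-1)/s; taking n > 4eN
-- contradicts c-competitiveness.

open import Defs
open import Data.Rational using (ℚ; _<_)
open import Relation.Nullary using (¬_)

open import Data.Nat using (ℕ; NonZero; zero; suc; _+_; _*_; _∸_; _≤_; z≤n; s≤s)
import Data.Nat.Properties as ℕP
open import Data.Nat.Tactic.RingSolver using (solve-∀)
open import Data.Nat.Coprimality using (1-coprimeTo) renaming (sym to coprime-sym)
open import Data.Fin using (Fin; zero; suc; toℕ)
open import Data.Vec using (Vec; []; _∷_; _∷ʳ_; map; replicate; lookup)
open import Data.Vec.Properties using (lookup-map)
open import Data.Product using (_×_; _,_)
open import Relation.Binary.PropositionalEquality
import Data.Integer as ℤ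
import Data.Integer.Properties as ℤP
import Data.Rational as ℚ
import Data.Rational.Properties as ℚP
import Data.Rational.Unnormalised as ℚᵘ
import Data.Rational.Unnormalised.Properties as ℚᵘP

pattern off = zero
pattern on  = suc zero

State : Set
State = Fin 2

flip : State → State
flip off = on
flip on  = off

hit : State → State → ℕ
hit off off = 1
hit off on  = 0
hit on  off = 0
hit on  on  = 1

costℕ : ∀ {n} → ℕ → ℕ → Vec State n → Vec State n → ℕ
costℕ N q []       []       = 0
costℕ N q (y ∷ ys) (z ∷ zs) = hit y z + N * (toℕ z ∸ q) + costℕ N (toℕ z) ys zs

hits : ∀ {n} → Vec State n → Vec State n → ℕ
hits []       []       = 0
hits (y ∷ ys) (z ∷ zs) = hit y z + hits ys zs

ups : ∀ {n} → State → Vec State n → ℕ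
ups p []       = 0
ups p (x ∷ xs) = (toℕ x ∸ toℕ p) + ups x xs

downs : ∀ {n} → State → Vec State n → ℕ
downs p []       = 0
downs p (x ∷ xs) = (toℕ p ∸ toℕ x) + downs x xs

cost-split : ∀ N {n} p (ys zs : Vec State n) →
             costℕ N (toℕ p) ys zs ≡ hits ys zs + N * ups p zs
cost-split N p []       []       = sym (ℕP.*-zeroʳ N)
cost-split N p (y ∷ ys) (z ∷ zs) = begin
  hit y z + N * u + costℕ N (toℕ z) ys zs  ≡⟨ cong (hit y z + N * u +_) (cost-split N z ys zs) ⟩
  hit y z + N * u + (hits ys zs + N * v)   ≡⟨ regroup N (hit y z) (hits ys zs) u v ⟩
  hit y z + hits ys zs + N * (u + v)       ∎
  where
  open ≡-Reasoning
  u : ℕ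
  u = toℕ z ∸ toℕ p
  v : ℕ
  v = ups z zs
  regroup : ∀ N a b u v → a + N * u + (b + N * v) ≡ a + b + N * (u + v)
  regroup = solve-∀

-- delay p xs = init (p ∷ xs): the adversary requests the algorithm's
-- previous state, so the requests against responses xs are delay off xs.
delay : ∀ {n} → State → Vec State n → Vec State n
delay p []       = []
delay p (x ∷ xs) = p ∷ delay x xs

step-kind : (p x : State) → hit p x + (toℕ x ∸ toℕ p) + (toℕ p ∸ toℕ x) ≡ 1
step-kind off off = refl
step-kind off on  = refl
step-kind on  off = refl
step-kind on  on  = refl

stay-up-or-down : ∀ {n} p (xs : Vec State n) → hits (delay p xs) xs + ups p xs + downs p xs ≡ n
stay-up-or-down p []       = refl
stay-up-or-down {suc n} p (x ∷ xs) = begin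
  (hit p x + h) + (u + U) + (d + D)  ≡⟨ regroup (hit p x) h u U d D ⟩
  (hit p x + u + d) + (h + U + D)    ≡⟨ cong₂ _+_ (step-kind p x) (stay-up-or-down x xs) ⟩
  suc n                              ∎
  where
  open ≡-Reasoning
  h : ℕ
  h = hits (delay x xs) xs
  u : ℕ
  u = toℕ x ∸ toℕ p
  d : ℕ
  d = toℕ p ∸ toℕ x
  U : ℕ
  U = ups x xs
  D : ℕ
  D = downs x xs
  regroup : ∀ a h u U d D → a + h + (u + U) + (d + D) ≡ a + u + d + (h + U + D)
  regroup = solve-∀

-- Per-step form of  (#downs) + final height = (#ups) + initial height.
step-height : (p x : State) → (toℕ p ∸ toℕ x) + toℕ x ≡ (toℕ x ∸ toℕ p) + toℕ p
step-height off off = refl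
step-height off on  = refl
step-height on  off = refl
step-height on  on  = refl

downs≤ups : ∀ {n} p (xs : Vec State n) → downs p xs ≤ ups p xs + toℕ p
downs≤ups p []       = z≤n
downs≤ups p (x ∷ xs) = begin
  d + downs x xs          ≤⟨ ℕP.+-monoʳ-≤ d (downs≤ups x xs) ⟩
  d + (ups x xs + toℕ x)  ≡⟨ regroup d (ups x xs) (toℕ x) ⟩
  (d + toℕ x) + ups x xs  ≡⟨ cong (_+ ups x xs) (step-height p x) ⟩
  (u + toℕ p) + ups x xs  ≡⟨ ℕP.+-assoc u (toℕ p) (ups x xs) ⟩
  u + (toℕ p + ups x xs)  ≡⟨ regroup u (toℕ p) (ups x xs) ⟩
  u + ups x xs + toℕ p    ∎
  where
  open ℕP.≤-Reasoning
  d : ℕ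
  d = toℕ p ∸ toℕ x
  u : ℕ
  u = toℕ x ∸ toℕ p
  regroup : ∀ a b c → a + (b + c) ≡ a + c + b
  regroup = solve-∀

-- delay p xs is a prefix of p ∷ xs, so it has no more up-moves.
ups-prefix : ∀ {n} q p (xs : Vec State n) → ups q (delay p xs) ≤ ups q (p ∷ xs)
ups-prefix q p []       = z≤n
ups-prefix q p (x ∷ xs) = ℕP.+-monoʳ-≤ (toℕ p ∸ toℕ q) (ups-prefix p x xs)

flip-step : (p x : State) → toℕ (flip x) ∸ toℕ (flip p) ≡ toℕ p ∸ toℕ x
flip-step off off = refl
flip-step off on  = refl
flip-step on  off = refl
flip-step on  on  = refl

ups-flip : ∀ {n} p (xs : Vec State n) → ups (flip p) (map flip xs) ≡ downs p xs
ups-flip p []       = refl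
ups-flip p (x ∷ xs) = cong₂ _+_ (flip-step p x) (ups-flip x xs)

map-flip-delay : ∀ {n} p (xs : Vec State n) → map flip (delay p xs) ≡ delay (flip p) (map flip xs)
map-flip-delay p []       = refl
map-flip-delay p (x ∷ xs) = cong (flip p ∷_) (map-flip-delay x xs)

hits-flip : ∀ {n} (ys : Vec State n) → hits ys (map flip ys) ≡ 0
hits-flip []         = refl
hits-flip (off ∷ ys) = hits-flip ys
hits-flip (on  ∷ ys) = hits-flip ys

hits-off+hits-on : ∀ {n} (ys : Vec State n) → hits ys (replicate n off) + hits ys (replicate n on) ≡ n
hits-off+hits-on []         = refl
hits-off+hits-on (off ∷ ys) = cong suc (hits-off+hits-on ys)
hits-off+hits-on {suc n} (on ∷ ys) = trans (ℕP.+-suc _ _) (cong suc (hits-off+hits-on ys))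

ups-constant : ∀ n p → ups p (replicate n p) ≡ 0
ups-constant zero    p = refl
ups-constant (suc n) p = cong₂ _+_ (ℕP.n∸n≡0 (toℕ p)) (ups-constant n p)

always-off : ∀ N {n} (ys : Vec State n) → costℕ N 0 ys (replicate n off) ≡ hits ys (replicate n off)
always-off N {n} ys = begin
  costℕ N 0 ys (replicate n off)           ≡⟨ cost-split N off ys _ ⟩
  hits ys (replicate n off) + N * ups off (replicate n off) ≡⟨ cong (λ k → hits ys (replicate n off) + N * k) (ups-constant n off) ⟩
  hits ys (replicate n off) + N * 0        ≡⟨ cong (hits ys (replicate n off) +_) (ℕP.*-zeroʳ N) ⟩
  hits ys (replicate n off) + 0            ≡⟨ ℕP.+-identityʳ _ ⟩
  hits ys (replicate n off)                ∎
  where open ≡-Reasoning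

always-on : ∀ N {n} (ys : Vec State n) → costℕ N 0 ys (replicate n on) ≤ hits ys (replicate n on) + N
always-on N {n} ys = begin
  costℕ N 0 ys (replicate n on)                      ≡⟨ cost-split N off ys _ ⟩
  hits ys (replicate n on) + N * ups off (replicate n on) ≤⟨ ℕP.+-monoʳ-≤ _ (ℕP.*-monoʳ-≤ N (switch-on-once n)) ⟩
  hits ys (replicate n on) + N * 1                   ≡⟨ cong (hits ys (replicate n on) +_) (ℕP.*-identityʳ N) ⟩
  hits ys (replicate n on) + N                       ∎
  where
  open ℕP.≤-Reasoning
  switch-on-once : ∀ n → ups off (replicate n on) ≤ 1
  switch-on-once zero    = z≤n
  switch-on-once (suc n) = ℕP.≤-reflexive (cong suc (ups-constant n on))

-- Offline schedule 3: opposite to every request.  It is never hit and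
-- switches on once initially and after each down-move of the algorithm.
opposite : ∀ N {n} (xs : Vec State n) →
           costℕ N 0 (delay off xs) (map flip (delay off xs)) ≤ N + N * downs off xs
opposite N {n} xs = begin
  costℕ N 0 ys (map flip ys)                     ≡⟨ cost-split N off ys _ ⟩
  hits ys (map flip ys) + N * ups off (map flip ys) ≡⟨ cong₂ (λ h w → h + N * ups off w) (hits-flip ys) (map-flip-delay off xs) ⟩
  N * ups off (delay on (map flip xs))           ≤⟨ ℕP.*-monoʳ-≤ N (ups-prefix off on (map flip xs)) ⟩
  N * (1 + ups on (map flip xs))                 ≡⟨ cong (λ k → N * (1 + k)) (ups-flip off xs) ⟩
  N * (1 + downs off xs)                         ≡⟨ ℕP.*-distribˡ-+ N 1 _ ⟩
  N * 1 + N * downs off xs                       ≡⟨ cong (_+ N * downs off xs) (ℕP.*-identityʳ N) ⟩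
  N + N * downs off xs                           ∎
  where
  open ℕP.≤-Reasoning
  ys : Vec State n
  ys = delay off xs

-- The counting argument in pure arithmetic.  With N = 4e ≥ 4, α = H + N·U,
-- n = H + U + D and D ≤ U, the bound (e+1)·α ≤ e·(n + 2N + N·D) implies
-- α ≤ 4eN, while N ≥ 2 gives n ≤ α.
arithmetic-core : ∀ e H U D → 1 ≤ e → D ≤ U →
                  suc e * (H + 4 * e * U) ≤ e * ((H + U + D) + 2 * (4 * e) + 4 * e * D) →
                  H + U + D ≤ 4 * e * (4 * e)
arithmetic-core e H U D 1≤e D≤U ratio = ℕP.≤-trans n≤α α≤4eN
  where
  open ℕP.≤-Reasoning
  N : ℕ
  N = 4 * e
  α : ℕ
  α = H + N * U
  n : ℕ
  n = H + U + D
  requests : n + N * D ≤ α + 2 * U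
  requests = begin
    H + U + D + N * D  ≤⟨ ℕP.+-mono-≤ (ℕP.+-monoʳ-≤ (H + U) D≤U) (ℕP.*-monoʳ-≤ N D≤U) ⟩
    H + U + U + N * U  ≡⟨ regroup H U (N * U) ⟩
    α + 2 * U          ∎
    where
    regroup : ∀ H U V → H + U + U + V ≡ H + V + 2 * U
    regroup = solve-∀
  α≤2eU+2eN : α ≤ 2 * e * U + 2 * e * N
  α≤2eU+2eN = ℕP.+-cancelˡ-≤ (e * α) _ _ (begin
    e * α + α                     ≡⟨ ℕP.+-comm (e * α) α ⟩
    suc e * α                     ≤⟨ ratio ⟩
    e * (n + 2 * N + N * D)       ≡⟨ cong (e *_) (regroup n (2 * N) (N * D)) ⟩
    e * ((n + N * D) + 2 * N)     ≤⟨ ℕP.*-monoʳ-≤ e (ℕP.+-monoˡ-≤ (2 * N) requests) ⟩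
    e * (α + 2 * U + 2 * N)       ≡⟨ expand e α U N ⟩
    e * α + (2 * e * U + 2 * e * N) ∎)
    where
    regroup : ∀ a b c → a + b + c ≡ a + c + b
    regroup = solve-∀
    expand : ∀ e α U N → e * (α + 2 * U + 2 * N) ≡ e * α + (2 * e * U + 2 * e * N)
    expand = solve-∀
  α≤4eN : α ≤ 4 * e * N
  α≤4eN = ℕP.+-cancelˡ-≤ α _ _ (begin
    α + α                                          ≤⟨ ℕP.+-mono-≤ α≤2eU+2eN α≤2eU+2eN ⟩
    (2 * e * U + 2 * e * N) + (2 * e * U + 2 * e * N) ≡⟨ expand e U ⟩
    N * U + 4 * e * N                              ≤⟨ ℕP.+-monoˡ-≤ (4 * e * N) (ℕP.m≤n+m (N * U) H) ⟩
    α + 4 * e * N                                  ∎)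
    where
    expand : ∀ e U → (2 * e * U + 2 * e * (4 * e)) + (2 * e * U + 2 * e * (4 * e))
                     ≡ 4 * e * U + 4 * e * (4 * e)
    expand = solve-∀
  n≤α : n ≤ α
  n≤α = begin
    H + U + D    ≤⟨ ℕP.+-monoʳ-≤ (H + U) D≤U ⟩
    H + U + U    ≡⟨ regroup H U ⟩
    H + 2 * U    ≤⟨ ℕP.+-monoʳ-≤ H (ℕP.*-monoˡ-≤ U 2≤N) ⟩
    α            ∎
    where
    regroup : ∀ H U → H + U + U ≡ H + 2 * U
    regroup = solve-∀
    2≤N : 2 ≤ N
    2≤N = ℕP.≤-trans (s≤s (s≤s z≤n)) (ℕP.*-monoʳ-≤ 4 1≤e)

three-schedules : ∀ s e → 3 * s ≡ suc e → ∀ N {n} (xs : Vec State n) →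
  (∀ zs → s * costℕ N 0 (delay off xs) xs ≤ e * costℕ N 0 (delay off xs) zs) →
  suc e * costℕ N 0 (delay off xs) xs ≤ e * (n + 2 * N + N * downs off xs)
three-schedules s e 3s≡1+e N {n} xs ratio = begin
  suc e * α                                 ≡⟨ cong (_* α) (sym 3s≡1+e) ⟩
  3 * s * α                                 ≡⟨ triple s α ⟩
  s * α + s * α + s * α                     ≤⟨ ℕP.+-mono-≤ (ℕP.+-mono-≤ vs-off vs-on) vs-opposite ⟩
  e * Z + e * (O + N) + e * (N + N * D)     ≡⟨ collect e Z O N D ⟩
  e * ((Z + O) + 2 * N + N * D)             ≡⟨ cong (λ k → e * (k + 2 * N + N * D)) (hits-off+hits-on ys) ⟩
  e * (n + 2 * N + N * D)                   ∎
  where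
  open ℕP.≤-Reasoning
  ys : Vec State n
  ys = delay off xs
  α : ℕ
  α = costℕ N 0 ys xs
  Z : ℕ
  Z = hits ys (replicate n off)
  O : ℕ
  O = hits ys (replicate n on)
  D : ℕ
  D = downs off xs
  vs-off : s * α ≤ e * Z
  vs-off = subst (λ k → s * α ≤ e * k) (always-off N ys) (ratio (replicate n off))
  vs-on : s * α ≤ e * (O + N)
  vs-on = ℕP.≤-trans (ratio (replicate n on)) (ℕP.*-monoʳ-≤ e (always-on N ys))
  vs-opposite : s * α ≤ e * (N + N * D)
  vs-opposite = ℕP.≤-trans (ratio (map flip ys)) (ℕP.*-monoʳ-≤ e (opposite N xs))
  triple : ∀ s α → 3 * s * α ≡ s * α + s * α + s * α
  triple = solve-∀
  collect : ∀ e Z O N D → e * Z + e * (O + N) + e * (N + N * D) ≡ e * ((Z + O) + 2 * N + N * D)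
  collect = solve-∀

horizon-bound : ∀ s e → 3 * s ≡ suc e → 1 ≤ e → ∀ {n} (xs : Vec State n) →
  (∀ zs → s * costℕ (4 * e) 0 (delay off xs) xs ≤ e * costℕ (4 * e) 0 (delay off xs) zs) →
  n ≤ 4 * e * (4 * e)
horizon-bound s e 3s≡1+e 1≤e {n} xs ratio =
  subst (_≤ 4 * e * (4 * e)) (stay-up-or-down off xs)
    (arithmetic-core e H U D 1≤e D≤U
      (subst₂ (λ a m → suc e * a ≤ e * (m + 2 * N + N * D)) (cost-split N off ys xs) (sym (stay-up-or-down off xs))
        (three-schedules s e 3s≡1+e N xs ratio)))
  where
  N : ℕ
  N = 4 * e
  ys : Vec State n
  ys = delay off xs
  H : ℕ
  H = hits ys xs
  U : ℕ
  U = ups off xs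
  D : ℕ
  D = downs off xs
  D≤U : D ≤ U
  D≤U = subst (D ≤_) (ℕP.+-identityʳ U) (downs≤ups off xs)

-- ℕ→ℚ n is the normalised fraction n/1, so it commutes with + and *.
ℕ→ℚ-mkℚ : ∀ n → ℕ→ℚ n ≡ ℚ.mkℚ (ℤ.+ n) 0 (coprime-sym (1-coprimeTo n))
ℕ→ℚ-mkℚ n = ℚP.normalize-coprime (coprime-sym (1-coprimeTo n))

ℕ→ℚ-+ : ∀ a b → ℕ→ℚ a ℚ.+ ℕ→ℚ b ≡ ℕ→ℚ (a + b)
ℕ→ℚ-+ a b rewrite ℕ→ℚ-mkℚ a | ℕ→ℚ-mkℚ b =
  cong (ℚ._/ 1) (trans (cong₂ ℤ._+_ (ℤP.*-identityʳ (ℤ.+ a)) (ℤP.*-identityʳ (ℤ.+ b))) (sym (ℤP.pos-+ a b)))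

ℕ→ℚ-* : ∀ a b → ℕ→ℚ a ℚ.* ℕ→ℚ b ≡ ℕ→ℚ (a * b)
ℕ→ℚ-* a b rewrite ℕ→ℚ-mkℚ a | ℕ→ℚ-mkℚ b = cong (ℚ._/ 1) (sym (ℤP.pos-* a b))

ℕ→ℚ-nonNeg : ∀ n → ℚ.0ℚ ℚ.≤ ℕ→ℚ n
ℕ→ℚ-nonNeg n = ℚP.nonNegative⁻¹ (ℕ→ℚ n) {{ℚP.normalize-nonNeg n 1}}

ℕ→ℚ-pos : ∀ n .{{_ : NonZero n}} → ℚ.0ℚ < ℕ→ℚ n
ℕ→ℚ-pos n = ℚP.positive⁻¹ (ℕ→ℚ n) {{ℚP.normalize-pos n 1}}

numerator<3·denominator : ∀ c → c < ℕ→ℚ 3 → ℚ.↥ c ℤ.≤ ℤ.+ (2 + 3 * ℚ.denominator-1 c)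
numerator<3·denominator c@(ℚ.mkℚ z d _) (ℚ.*<* c<3) =
  subst (z ℤ.≤_) (cong ℤ.+_ (pred-thrice d)) (ℤP.i<j⇒i≤pred[j] {j = ℤ.+ (3 * suc d)}
    (subst₂ ℤ._<_ (ℤP.*-identityʳ z) (sym (ℤP.pos-* 3 (suc d))) c<3))
  where
  pred-thrice : ∀ d → d + (suc d + (suc d + 0)) ≡ 2 + 3 * d
  pred-thrice = solve-∀

cross-multiply : ∀ c a b → ℕ→ℚ a ℚ.≤ c ℚ.* ℕ→ℚ b →
                 ℤ.+ (suc (ℚ.denominator-1 c) * a) ℤ.≤ ℚ.↥ c ℤ.* ℤ.+ b
cross-multiply c@(ℚ.mkℚ z d _) a b a≤cb
  with ℚᵘP.≤-respʳ-≃ (ℚP.toℚᵘ-homo-* c (ℕ→ℚ b)) (ℚP.toℚᵘ-mono-≤ a≤cb)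
... | a≤cbᵘ rewrite ℕ→ℚ-mkℚ a | ℕ→ℚ-mkℚ b with a≤cbᵘ
... | ℚᵘ.*≤* le = subst₂ ℤ._≤_ lhs (ℤP.*-identityʳ (z ℤ.* ℤ.+ b)) le
  where
  lhs : ℤ.+ a ℤ.* ℤ.+ suc (d * 1) ≡ ℤ.+ (suc d * a)
  lhs = trans (sym (ℤP.pos-* a (suc (d * 1)))) (cong ℤ.+_ (trans (cong (λ k → a * suc k) (ℕP.*-identityʳ d)) (ℕP.*-comm a (suc d))))

below-three : ∀ c → c < ℕ→ℚ 3 → ∀ a b → ℕ→ℚ a ℚ.≤ c ℚ.* ℕ→ℚ b →
              suc (ℚ.denominator-1 c) * a ≤ (2 + 3 * ℚ.denominator-1 c) * b
below-three c c<3 a b a≤cb =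
  ℤP.drop‿+≤+ (ℤP.≤-trans (cross-multiply c a b a≤cb) (subst (ℚ.↥ c ℤ.* ℤ.+ b ℤ.≤_) as-ℕ scaled))
  where
  scaled : ℚ.↥ c ℤ.* ℤ.+ b ℤ.≤ ℤ.+ (2 + 3 * ℚ.denominator-1 c) ℤ.* ℤ.+ b
  scaled = ℤP.*-monoʳ-≤-nonNeg (ℤ.+ b) (numerator<3·denominator c c<3)
  as-ℕ : ℤ.+ (2 + 3 * ℚ.denominator-1 c) ℤ.* ℤ.+ b ≡ ℤ.+ ((2 + 3 * ℚ.denominator-1 c) * b)
  as-ℕ = sym (ℤP.pos-* (2 + 3 * ℚ.denominator-1 c) b)

penalty : State → Fn 1
penalty y z = ℕ→ℚ (hit y z)

-- F y is nonnegative, and convex since {0,1} has no interior point.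
penalty-valid : ∀ {n} (ys : Vec State n) (i : Fin n) →
                NonNeg (lookup (map penalty ys) i) × Convex (lookup (map penalty ys) i)
penalty-valid ys i rewrite lookup-map i penalty ys =
  (λ z → ℕ→ℚ-nonNeg (hit (lookup ys i) z)) , λ { x p q (s≤s (s≤s ())) }

costFrom-penalty : ∀ N q {n} (ys zs : Vec State n) →
                   costFrom (ℕ→ℚ N) q (map penalty ys) zs ≡ ℕ→ℚ (costℕ N q ys zs)
costFrom-penalty N q []       []       = refl
costFrom-penalty N q (y ∷ ys) (z ∷ zs) = begin
  ℕ→ℚ (hit y z) ℚ.+ ℕ→ℚ N ℚ.* ℕ→ℚ (toℕ z ∸ q) ℚ.+ costFrom (ℕ→ℚ N) (toℕ z) (map penalty ys) zs
    ≡⟨ cong₂ (λ s r → ℕ→ℚ (hit y z) ℚ.+ s ℚ.+ r) (ℕ→ℚ-* N (toℕ z ∸ q)) (costFrom-penalty N (toℕ z) ys zs) ⟩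
  ℕ→ℚ (hit y z) ℚ.+ ℕ→ℚ (N * (toℕ z ∸ q)) ℚ.+ ℕ→ℚ (costℕ N (toℕ z) ys zs)
    ≡⟨ cong (ℚ._+ ℕ→ℚ (costℕ N (toℕ z) ys zs)) (ℕ→ℚ-+ (hit y z) (N * (toℕ z ∸ q))) ⟩
  ℕ→ℚ (hit y z + N * (toℕ z ∸ q)) ℚ.+ ℕ→ℚ (costℕ N (toℕ z) ys zs)
    ≡⟨ ℕ→ℚ-+ (hit y z + N * (toℕ z ∸ q)) (costℕ N (toℕ z) ys zs) ⟩
  ℕ→ℚ (costℕ N q (y ∷ ys) (z ∷ zs)) ∎
  where open ≡-Reasoning

respond : OnlineAlg → ℚ → ∀ {k} → Vec (Fn 1) k → State → (n : ℕ) → Vec State n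
respond A β hist p zero    = []
respond A β hist p (suc n) = x ∷ respond A β (hist ∷ʳ penalty p) x n
  where x = A 1 β (hist ∷ʳ penalty p)

-- Running the algorithm on the requests  map F (delay p xs)  for these
-- responses xs reproduces xs: the adversary is consistent.
run-respond : ∀ A β {k} (hist : Vec (Fn 1) k) p n →
              runFrom A β hist (map penalty (delay p (respond A β hist p n))) ≡ respond A β hist p n
run-respond A β hist p zero    = refl
run-respond A β hist p (suc n) =
  cong (A 1 β (hist ∷ʳ penalty p) ∷_) (run-respond A β (hist ∷ʳ penalty p) (A 1 β (hist ∷ʳ penalty p)) n)

theorem5p1 : (A : OnlineAlg) (c : ℚ) → c < ℕ→ℚ 3 → ¬ Competitive A c
theorem5p1 A c c<3 competitive = ℕP.<-irrefl refl (horizon-bound s e 3s≡1+e (s≤s z≤n) xs ratio)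
  where
  d : ℕ
  d = ℚ.denominator-1 c
  s : ℕ
  s = suc d
  e : ℕ
  e = 2 + 3 * d
  N : ℕ
  N = 4 * e
  T : ℕ
  T = suc (4 * e * N)
  xs : Vec State T
  xs = respond A (ℕ→ℚ N) [] off T
  ys : Vec State T
  ys = delay off xs
  3s≡1+e : 3 * s ≡ suc e
  3s≡1+e = thrice d
    where
    thrice : ∀ d → 3 * suc d ≡ suc (2 + 3 * d)
    thrice = solve-∀
  ratio : ∀ zs → s * costℕ N 0 ys xs ≤ e * costℕ N 0 ys zs
  ratio zs = below-three c c<3 (costℕ N 0 ys xs) (costℕ N 0 ys zs)
    (subst₂ (λ a b → a ℚ.≤ c ℚ.* b)
      (trans (cong (costFrom (ℕ→ℚ N) 0 (map penalty ys)) (run-respond A (ℕ→ℚ N) [] off T)) (costFrom-penalty N 0 ys xs))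
      (costFrom-penalty N 0 ys zs)
      (competitive T 1 (ℕ→ℚ N) (ℕ→ℚ-pos N) (map penalty ys) (penalty-valid ys) zs))
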